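{- Let $E=(e_X,e_Y,R)$ be a 0-coherent extension polarity extending the poset $P$, let $i_X:X\to\overline{X}$ and $i_Y:Y\to\overline{Y}$ be order embeddings with $\overline{X}\cap\overline{Y}=\emptyset$, define $\overline{R}\subseteq\overline{X}\times\overline{Y}$ by $x'\mathrel{\overline{R}}y'$ iff there are $x\in X,y\in Y$ with $x'\le_{\overline{X}}i_X(x)$, $i_Y(y)\le_{\overline{Y}}y'$ and $x\mathrel{R}y$, and let $\overline{E}=(i_X\circ e_X,i_Y\circ e_Y,\overline{R})$. Then: (1) for $n\in\{1,2\}$, if $\overline{E}$ is $n$-coherent then so is $E$; (2) if $i_X$ preserves all meets in $X$ of subsets of $e_X[P]$ that exist, and $i_Y$ preserves all joins in $Y$ of subsets of $e_Y[P]$ that exist, then whenever $\overline{E}$ is 3-coherent so is $E$, and whenever $\overline{E}$ is a Galois polarity so is $E$.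
   Context: For a poset $Q$, $q^\uparrow=\{r:r\ge q\}$, $q^\downarrow=\{r:r\le q\}$. An order embedding $e:P\to Q$ is a meet-extension if $q=\bigwedge e[e^{ -1}(q^\uparrow)]$ for all $q$, and a join-extension if $q=\bigvee e[e^{ -1}(q^\downarrow)]$ for all $q$. An extension polarity is a triple $(e_X,e_Y,R)$ where $P$ is a poset, $e_X:P\to X$, $e_Y:P\to Y$ order embeddings into disjoint posets, $R\subseteq X\times Y$. Conditions (variables over $X$, $Y$, $P$ as appropriate): (C1) $x_1\le_X x_2$ and $x_2\mathrel{R}y$ imply $x_1\mathrel{R}y$; (C2) $y_1\le_Y y_2$ and $x\mathrel{R}y_1$ imply $x\mathrel{R}y_2$; (C3) $e_X(p)\mathrel{R}e_Y(p)$ for all $p$; (C4) $x\mathrel{R}e_Y(p)$ and $e_X(p)\mathrel{R}y$ imply $x\mathrel{R}y$; (C5) $x_1\mathrel{R}e_Y(p)$ and $e_X(p)\le_X x_2$ imply $x_1\le_X x_2$; (C6) $y_1\le_Y e_Y(p)$ and $e_X(p)\mathrel{R}y_2$ imply $y_1\le_Y y_2$; (C7) if $S\subseteq P$, $\bigwedge e_X[S]=x$ in $X$, $x\mathrel{R}y_2$ and $y_1\le_Y e_Y(p)$ for all $p\in S$, then $y_1\le_Y y_2$; (C8) if $T\subseteq P$, $\bigvee e_Y[T]=y$ in $Y$, $x_1\mathrel{R}y$ and $e_X(q)\le_X x_2$ for all $q\in T$, then $x_1\le_X x_2$. The polarity is 0-coherent if (C1),(C2) hold; 1-coherent if (C1)–(C4);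 2-coherent if (C1)–(C6); 3-coherent if (C1)–(C8). A Galois polarity is a 3-coherent extension polarity with $e_X$ a meet-extension and $e_Y$ a join-extension. -}

module Defs where

open import Level using (Level; _⊔_; suc)
open import Data.Product using (Σ; ∃; ∃-syntax; _×_; _,_)
open import Relation.Binary using (REL; Poset)
open import Data.Unit.Polymorphic using (⊤)
open import Relation.Unary using (Pred; _∈_; _⊆_)

module _ {ℓ : Level} where

  IsOrderEmbedding : (P Q : Poset ℓ ℓ ℓ) → (Poset.Carrier P → Poset.Carrier Q) → Set ℓ
  IsOrderEmbedding P Q e =
    ∀ {p q} → (Poset._≤_ P p q → Poset._≤_ Q (e p) (e q))
            × (Poset._≤_ Q (e p) (e q) → Poset._≤_ P p q)

  image : (P Q : Poset ℓ ℓ ℓ) → (Poset.Carrier P → Poset.Carrier Q) →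
          Pred (Poset.Carrier P) ℓ → Pred (Poset.Carrier Q) ℓ
  image P Q e S y = ∃[ p ] (S p × Poset._≈_ Q y (e p))

  IsMeet : (X : Poset ℓ ℓ ℓ) → Pred (Poset.Carrier X) ℓ → Poset.Carrier X → Set ℓ
  IsMeet X A x = (∀ a → a ∈ A → Poset._≤_ X x a)
               × (∀ z → (∀ a → a ∈ A → Poset._≤_ X z a) → Poset._≤_ X z x)

  IsJoin : (X : Poset ℓ ℓ ℓ) → Pred (Poset.Carrier X) ℓ → Poset.Carrier X → Set ℓ
  IsJoin X A x = (∀ a → a ∈ A → Poset._≤_ X a x)
               × (∀ z → (∀ a → a ∈ A → Poset._≤_ X a z) → Poset._≤_ X x z)

  IsMeetExtension : (P Q : Poset ℓ ℓ ℓ) → (Poset.Carrier P → Poset.Carrier Q) → Set ℓ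
  IsMeetExtension P Q e =
    ∀ q → IsMeet Q (image P Q e (λ p → Poset._≤_ Q q (e p))) q

  IsJoinExtension : (P Q : Poset ℓ ℓ ℓ) → (Poset.Carrier P → Poset.Carrier Q) → Set ℓ
  IsJoinExtension P Q e =
    ∀ q → IsJoin Q (image P Q e (λ p → Poset._≤_ Q (e p) q)) q

  PreservesMeetsOfImage : (P X X' : Poset ℓ ℓ ℓ) (e : Poset.Carrier P → Poset.Carrier X)
                          (i : Poset.Carrier X → Poset.Carrier X') → Set (suc ℓ)
  PreservesMeetsOfImage P X X' e i =
    ∀ (A : Pred (Poset.Carrier X) ℓ) x → A ⊆ image P X e (λ _ → ⊤) →
      IsMeet X A x → IsMeet X' (image X X' i A) (i x)

  PreservesJoinsOfImage : (P Y Y' : Poset ℓ ℓ ℓ) (e : Poset.Carrier P → Poset.Carrier Y)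
                          (i : Poset.Carrier Y → Poset.Carrier Y') → Set (suc ℓ)
  PreservesJoinsOfImage P Y Y' e i =
    ∀ (A : Pred (Poset.Carrier Y) ℓ) y → A ⊆ image P Y e (λ _ → ⊤) →
      IsJoin Y A y → IsJoin Y' (image Y Y' i A) (i y)

  liftRel : (X Y X' Y' : Poset ℓ ℓ ℓ)
            (iX : Poset.Carrier X → Poset.Carrier X') (iY : Poset.Carrier Y → Poset.Carrier Y')
            (R : REL (Poset.Carrier X) (Poset.Carrier Y) ℓ) →
            REL (Poset.Carrier X') (Poset.Carrier Y') ℓ
  liftRel X Y X' Y' iX iY R x' y' =
    ∃[ x ] ∃[ y ] (Poset._≤_ X' x' (iX x) × Poset._≤_ Y' (iY y) y' × R x y)

module Polarity {ℓ : Level} (P X Y : Poset ℓ ℓ ℓ)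
  (eX : Poset.Carrier P → Poset.Carrier X) (eY : Poset.Carrier P → Poset.Carrier Y)
  (R : REL (Poset.Carrier X) (Poset.Carrier Y) ℓ) where

  private
    module P = Poset P
    module X = Poset X
    module Y = Poset Y

  C1 : Set ℓ
  C1 = ∀ {x₁ x₂ y} → x₁ X.≤ x₂ → R x₂ y → R x₁ y

  C2 : Set ℓ
  C2 = ∀ {x y₁ y₂} → y₁ Y.≤ y₂ → R x y₁ → R x y₂

  C3 : Set ℓ
  C3 = ∀ p → R (eX p) (eY p)

  C4 : Set ℓ
  C4 = ∀ {x y p} → R x (eY p) → R (eX p) y → R x y

  C5 : Set ℓ
  C5 = ∀ {x₁ x₂ p} → R x₁ (eY p) → eX p X.≤ x₂ → x₁ X.≤ x₂

  C6 : Set ℓ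
  C6 = ∀ {y₁ y₂ p} → y₁ Y.≤ eY p → R (eX p) y₂ → y₁ Y.≤ y₂

  C7 : Set (suc ℓ)
  C7 = ∀ (S : Pred P.Carrier ℓ) x y₁ y₂ → IsMeet X (image P X eX S) x →
       R x y₂ → (∀ p → p ∈ S → y₁ Y.≤ eY p) → y₁ Y.≤ y₂

  C8 : Set (suc ℓ)
  C8 = ∀ (T : Pred P.Carrier ℓ) y x₁ x₂ → IsJoin Y (image P Y eY T) y →
       R x₁ y → (∀ q → q ∈ T → eX q X.≤ x₂) → x₁ X.≤ x₂

  ExtensionPolarity : Set ℓ
  ExtensionPolarity = IsOrderEmbedding P X eX × IsOrderEmbedding P Y eY

  ZeroCoherent : Set ℓ
  ZeroCoherent = ExtensionPolarity × C1 × C2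

  OneCoherent : Set ℓ
  OneCoherent = ZeroCoherent × C3 × C4

  TwoCoherent : Set ℓ
  TwoCoherent = OneCoherent × C5 × C6

  ThreeCoherent : Set (suc ℓ)
  ThreeCoherent = TwoCoherent × C7 × C8

  GaloisPolarity : Set (suc ℓ)
  GaloisPolarity = ThreeCoherent × IsMeetExtension P X eX × IsJoinExtension P Y eY

{-# OPTIONS --safe #-}
module Submission where

open import Defs
open import Level using (Level)
open import Data.Product using (_×_; _,_; proj₁; proj₂)
open import Function using (_∘_)
open import Relation.Binary using (REL; Poset)
open import Relation.Binary.Properties.Poset using (≥-poset)
open import Relation.Unary using (Pred; _⊆_)

-- Since R is down-closed in X and up-closed in Y and i_X, i_Y reflect the order,
-- i_X x R̄ i_Y y holds exactly when x R y.  Every coherence condition of Ē,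
-- instantiated at images of points of X and Y, therefore pulls back to E.  For (C7),
-- (C8) and the extension properties the only extra ingredient is that i_X, i_Y carry
-- the relevant meets and joins of X, Y to meets and joins of X̄, Ȳ.  Statements about
-- joins are the meet statements for the opposite posets ≥-poset, which keep ≈.

module _ {ℓ : Level} where

  module _ (P Q : Poset ℓ ℓ ℓ) {e : Poset.Carrier P → Poset.Carrier Q}
           (emb : IsOrderEmbedding P Q e) where

    private
      module P = Poset P
      module Q = Poset Q

    IsOrderEmbedding-cong : ∀ {p q} → p P.≈ q → e p Q.≈ e q
    IsOrderEmbedding-cong p≈q =
      Q.antisym (proj₁ emb (P.reflexive p≈q)) (proj₁ emb (P.reflexive (P.Eq.sym p≈q)))

    IsOrderEmbedding-dual : IsOrderEmbedding (≥-poset P) (≥-poset Q) e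
    IsOrderEmbedding-dual = proj₁ emb , proj₂ emb

  IsMeet-cong : (Q : Poset ℓ ℓ ℓ) {A B : Pred (Poset.Carrier Q) ℓ} {x : Poset.Carrier Q} →
                A ⊆ B → B ⊆ A → IsMeet Q A x → IsMeet Q B x
  IsMeet-cong Q A⊆B B⊆A (lower , greatest) =
    (λ b b∈B → lower b (B⊆A b∈B)) ,
    (λ z z-lower → greatest z (λ a a∈A → z-lower a (A⊆B a∈A)))

  module _ (P Q Q' : Poset ℓ ℓ ℓ) (e : Poset.Carrier P → Poset.Carrier Q)
           {i : Poset.Carrier Q → Poset.Carrier Q'} (emb : IsOrderEmbedding Q Q' i)
           (S : Pred (Poset.Carrier P) ℓ) where

    private
      module Q = Poset Q
      module Q' = Poset Q'

    image-image⊆image-∘ : image Q Q' i (image P Q e S) ⊆ image P Q' (i ∘ e) S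
    image-image⊆image-∘ (x , (p , p∈S , x≈ep) , a≈ix) =
      p , p∈S , Q'.Eq.trans a≈ix (IsOrderEmbedding-cong Q Q' emb x≈ep)

    image-∘⊆image-image : image P Q' (i ∘ e) S ⊆ image Q Q' i (image P Q e S)
    image-∘⊆image-image (p , p∈S , a≈iep) = e p , (p , p∈S , Q.Eq.refl) , a≈iep

  IsMeet-image-∘ : (P Q Q' : Poset ℓ ℓ ℓ) {e : Poset.Carrier P → Poset.Carrier Q}
                   {i : Poset.Carrier Q → Poset.Carrier Q'} →
                   PreservesMeetsOfImage P Q Q' e i → IsOrderEmbedding Q Q' i →
                   ∀ {S x} → IsMeet Q (image P Q e S) x → IsMeet Q' (image P Q' (i ∘ e) S) (i x)
  IsMeet-image-∘ P Q Q' {e} preserves emb {S} {x} meet =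
    IsMeet-cong Q' (image-image⊆image-∘ P Q Q' e emb S) (image-∘⊆image-image P Q Q' e emb S)
      (preserves (image P Q e S) x (λ (p , _ , x≈ep) → p , _ , x≈ep) meet)

  IsJoin-image-∘ : (P Q Q' : Poset ℓ ℓ ℓ) {e : Poset.Carrier P → Poset.Carrier Q}
                   {i : Poset.Carrier Q → Poset.Carrier Q'} →
                   PreservesJoinsOfImage P Q Q' e i → IsOrderEmbedding Q Q' i →
                   ∀ {S y} → IsJoin Q (image P Q e S) y → IsJoin Q' (image P Q' (i ∘ e) S) (i y)
  IsJoin-image-∘ P Q Q' preserves emb =
    IsMeet-image-∘ P (≥-poset Q) (≥-poset Q') preserves (IsOrderEmbedding-dual Q Q' emb)

  IsMeetExtension-reflect : (P Q Q' : Poset ℓ ℓ ℓ) {e : Poset.Carrier P → Poset.Carrier Q}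
                            {i : Poset.Carrier Q → Poset.Carrier Q'} →
                            IsOrderEmbedding Q Q' i →
                            IsMeetExtension P Q' (i ∘ e) → IsMeetExtension P Q e
  IsMeetExtension-reflect P Q Q' {e} {i} emb meetExt q = lower , greatest
    where
    module Q = Poset Q
    module Q' = Poset Q'

    lower : ∀ a → image P Q e (λ p → q Q.≤ e p) a → q Q.≤ a
    lower a (p , q≤ep , a≈ep) = Q.trans q≤ep (Q.reflexive (Q.Eq.sym a≈ep))

    greatest : ∀ z → (∀ a → image P Q e (λ p → q Q.≤ e p) a → z Q.≤ a) → z Q.≤ q
    greatest z z-lower = proj₂ emb (proj₂ (meetExt (i q)) (i z) i[z]-lower)
      where
      i[z]-lower : ∀ a → image P Q' (i ∘ e) (λ p → i q Q'.≤ i (e p)) a → i z Q'.≤ a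
      i[z]-lower a (p , iq≤iep , a≈iep) =
        Q'.trans (proj₁ emb (z-lower (e p) (p , proj₂ emb iq≤iep , Q.Eq.refl)))
                 (Q'.reflexive (Q'.Eq.sym a≈iep))

  IsJoinExtension-reflect : (P Q Q' : Poset ℓ ℓ ℓ) {e : Poset.Carrier P → Poset.Carrier Q}
                            {i : Poset.Carrier Q → Poset.Carrier Q'} →
                            IsOrderEmbedding Q Q' i →
                            IsJoinExtension P Q' (i ∘ e) → IsJoinExtension P Q e
  IsJoinExtension-reflect P Q Q' emb =
    IsMeetExtension-reflect P (≥-poset Q) (≥-poset Q') (IsOrderEmbedding-dual Q Q' emb)

module Reflection {ℓ : Level} (P X Y X' Y' : Poset ℓ ℓ ℓ)
    (eX : Poset.Carrier P → Poset.Carrier X) (eY : Poset.Carrier P → Poset.Carrier Y)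
    (R : REL (Poset.Carrier X) (Poset.Carrier Y) ℓ)
    (iX : Poset.Carrier X → Poset.Carrier X') (iY : Poset.Carrier Y → Poset.Carrier Y')
    (embX : IsOrderEmbedding X X' iX) (embY : IsOrderEmbedding Y Y' iY) where

  private
    module X' = Poset X'
    module Y' = Poset Y'
    module E = Polarity P X Y eX eY R
    R̄ = liftRel X Y X' Y' iX iY R
    module Ē = Polarity P X' Y' (iX ∘ eX) (iY ∘ eY) R̄

  liftRel-extends : ∀ {x y} → R x y → R̄ (iX x) (iY y)
  liftRel-extends {x} {y} xRy = x , y , X'.refl , Y'.refl , xRy

  liftRel-reflects : E.C1 → E.C2 → ∀ {x y} → R̄ (iX x) (iY y) → R x y
  liftRel-reflects c1 c2 (_ , _ , ix≤ix₀ , iy₀≤iy , x₀Ry₀) =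
    c1 (proj₂ embX ix≤ix₀) (c2 (proj₂ embY iy₀≤iy) x₀Ry₀)

  C3-reflect : E.C1 → E.C2 → Ē.C3 → E.C3
  C3-reflect c1 c2 c̄3 p = liftRel-reflects c1 c2 (c̄3 p)

  C4-reflect : E.C1 → E.C2 → Ē.C4 → E.C4
  C4-reflect c1 c2 c̄4 xRep epRy =
    liftRel-reflects c1 c2 (c̄4 (liftRel-extends xRep) (liftRel-extends epRy))

  C5-reflect : Ē.C5 → E.C5
  C5-reflect c̄5 xRep ep≤x = proj₂ embX (c̄5 (liftRel-extends xRep) (proj₁ embX ep≤x))

  C6-reflect : Ē.C6 → E.C6
  C6-reflect c̄6 y≤ep epRy = proj₂ embY (c̄6 (proj₁ embY y≤ep) (liftRel-extends epRy))

  C7-reflect : PreservesMeetsOfImage P X X' eX iX → Ē.C7 → E.C7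
  C7-reflect preserves c̄7 S x y₁ y₂ meet xRy₂ y₁-lower =
    proj₂ embY (c̄7 S (iX x) (iY y₁) (iY y₂)
      (IsMeet-image-∘ P X X' preserves embX meet) (liftRel-extends xRy₂)
      (λ p p∈S → proj₁ embY (y₁-lower p p∈S)))

  C8-reflect : PreservesJoinsOfImage P Y Y' eY iY → Ē.C8 → E.C8
  C8-reflect preserves c̄8 T y x₁ x₂ join x₁Ry x₂-upper =
    proj₂ embX (c̄8 T (iY y) (iX x₁) (iX x₂)
      (IsJoin-image-∘ P Y Y' preserves embY join) (liftRel-extends x₁Ry)
      (λ q q∈T → proj₁ embX (x₂-upper q q∈T)))

  OneCoherent-reflect : E.ZeroCoherent → Ē.OneCoherent → E.OneCoherent
  OneCoherent-reflect E₀@(_ , c1 , c2) (_ , c̄3 , c̄4) =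
    E₀ , C3-reflect c1 c2 c̄3 , C4-reflect c1 c2 c̄4

  TwoCoherent-reflect : E.ZeroCoherent → Ē.TwoCoherent → E.TwoCoherent
  TwoCoherent-reflect E₀ (Ē₁ , c̄5 , c̄6) =
    OneCoherent-reflect E₀ Ē₁ , C5-reflect c̄5 , C6-reflect c̄6

  module _ (preservesMeets : PreservesMeetsOfImage P X X' eX iX)
           (preservesJoins : PreservesJoinsOfImage P Y Y' eY iY)
           (E₀ : E.ZeroCoherent) where

    ThreeCoherent-reflect : Ē.ThreeCoherent → E.ThreeCoherent
    ThreeCoherent-reflect (Ē₂ , c̄7 , c̄8) =
      TwoCoherent-reflect E₀ Ē₂ , C7-reflect preservesMeets c̄7 , C8-reflect preservesJoins c̄8

    GaloisPolarity-reflect : Ē.GaloisPolarity → E.GaloisPolarity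
    GaloisPolarity-reflect (Ē₃ , meetExt , joinExt) =
      ThreeCoherent-reflect Ē₃ ,
      IsMeetExtension-reflect P X X' embX meetExt ,
      IsJoinExtension-reflect P Y Y' embY joinExt

corollary6p12 : {ℓ : Level} (P X Y X' Y' : Poset ℓ ℓ ℓ)
    (eX : Poset.Carrier P → Poset.Carrier X) (eY : Poset.Carrier P → Poset.Carrier Y)
    (R : REL (Poset.Carrier X) (Poset.Carrier Y) ℓ)
    (iX : Poset.Carrier X → Poset.Carrier X') (iY : Poset.Carrier Y → Poset.Carrier Y') →
    Polarity.ZeroCoherent P X Y eX eY R →
    IsOrderEmbedding X X' iX → IsOrderEmbedding Y Y' iY →
    ((Polarity.OneCoherent P X' Y' (iX ∘ eX) (iY ∘ eY) (liftRel X Y X' Y' iX iY R) →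
       Polarity.OneCoherent P X Y eX eY R)
     × (Polarity.TwoCoherent P X' Y' (iX ∘ eX) (iY ∘ eY) (liftRel X Y X' Y' iX iY R) →
       Polarity.TwoCoherent P X Y eX eY R))
    × (PreservesMeetsOfImage P X X' eX iX → PreservesJoinsOfImage P Y Y' eY iY →
       (Polarity.ThreeCoherent P X' Y' (iX ∘ eX) (iY ∘ eY) (liftRel X Y X' Y' iX iY R) →
         Polarity.ThreeCoherent P X Y eX eY R)
       × (Polarity.GaloisPolarity P X' Y' (iX ∘ eX) (iY ∘ eY) (liftRel X Y X' Y' iX iY R) →
         Polarity.GaloisPolarity P X Y eX eY R))
corollary6p12 P X Y X' Y' eX eY R iX iY E₀ embX embY =
  (OneCoherent-reflect E₀ , TwoCoherent-reflect E₀) ,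
  λ preservesMeets preservesJoins →
    ThreeCoherent-reflect preservesMeets preservesJoins E₀ ,
    GaloisPolarity-reflect preservesMeets preservesJoins E₀
  where open Reflection P X Y X' Y' eX eY R iX iY embX embY
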